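{- Let $S$ be a recursively axiomatized theory in the language of first order arithmetic which extends Peano arithmetic, and let $S_\Box$ be the formal system built from $S$ as described in the context. Suppose $S$ is sound, i.e., all axioms of $S$ are true in the standard model of arithmetic. If $A$ is a sentence of first order arithmetic (not involving $\Box$) which is false in the standard model, then $A$ is not a theorem of $S_\Box$, and for every $k\geq 1$ the sentence $\Box^k\ulcorner A\urcorner$ is not a theorem of $S_\Box$.
   Context: Conventions: all systems use intuitionistic first order logic; a classical theory such as PA is treated as an intuitionistic system whose non-logical axioms include every instance $A \vee \neg A$ for $A$ in its language. $\perp$ denotes the formula $0=1$, and $\neg A$ abbreviates $A \to \perp$. Formal proofs contain only sentences: all axioms are sentences (universal closures), generalization is expressed by the axioms $(\forall n_1,\ldots,n_k)(A\to B)\to(\forall n_2,\ldots,n_k)(A\to(\forall n_1)B)$ (when $n_1$ is not free in $A$) and $(\forall n_1,\ldots,n_k)(A\to B)\to(\forall n_2,\ldots,n_k)((\exists n_1)A\to B)$ (when $n_1$ is not free in $B$), and the only deduction rule is universally quantified modus ponens: from $(\forall n_1,\ldots,n_k)A$ and $(\forall n_1,\ldots,n_k)(A\to B)$ infer $(\forall n_1,\ldots,n_k)B$. The system $S_\Box$: its language is the language of first order arithmetic enriched by one unary relation symbol $\Box$ (read "is assertible"), with a fixed Gödel numbering; $\ulcorner A\urcorner$ is the Gödel number of $A$ and $\bar n$ is the $n$th numeral. The main axioms of $S_\Box$ are the universal closures of: (i) the non-logical axioms of $S$; (ii) all instances of the induction scheme and of the logical axiom schemes for formulas of the language of $S_\Box$;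 (iii) for all formulas $A,B$ of the language of $S_\Box$ (with the evident arithmetization of substitution of numerals): (1) $\Box\ulcorner A\vee B\urcorner\leftrightarrow \Box\ulcorner A\urcorner\vee\Box\ulcorner B\urcorner$; (2) $\Box\ulcorner A\wedge B\urcorner\leftrightarrow\Box\ulcorner A\urcorner\wedge\Box\ulcorner B\urcorner$; (3) $(\exists n)\Box\ulcorner A(\bar n)\urcorner\to\Box\ulcorner(\exists n)A(n)\urcorner$; (4) $\Box\ulcorner(\forall n)A(n)\urcorner\leftrightarrow(\forall n)\Box\ulcorner A(\bar n)\urcorner$; (5) $\Box\ulcorner A\to B\urcorner\to(\Box\ulcorner A\urcorner\to\Box\ulcorner B\urcorner)$; (6) (capture) $A(n_1,\ldots,n_k)\to\Box\ulcorner A(\bar n_1,\ldots,\bar n_k)\urcorner$ for every formula $A$ with free variables $n_1,\ldots,n_k$. Let ${\rm Ax}(g)$ be an arithmetical formula expressing that $g$ is the Gödel number of a main axiom, chosen so that whenever ${\rm Ax}(\bar g)$ holds it is provable in PA. In addition to the main axioms, $S_\Box$ has one jump axiom $(\forall g)({\rm Ax}(g)\to\Box(g))$. Notation: $\Box^1\ulcorner A\urcorner$ is $\Box\ulcorner A\urcorner$, and $\Box^{k+1}\ulcorner A\urcorner$ is $\Box\ulcorner\Box^k\ulcorner A\urcorner\urcorner$ (i.e., $k$ nested applications of $\Box$ to Gödel numbers). -}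

module Defs where

open import Data.Bool using (Bool; true; false)
open import Data.Nat using (ℕ; zero; suc; _+_; _*_; _^_; _≤_)
open import Data.Fin using (Fin; toℕ) renaming (zero to fz; suc to fs)
open import Data.Vec using (Vec; []; _∷_; lookup)
open import Data.Product using (Σ; _×_)
open import Data.Sum using (_⊎_)
open import Relation.Nullary using (¬_)
open import Relation.Binary.PropositionalEquality using (_≡_)
open import Function.Bundles using (_⇔_)

-- The Bool index says
-- whether the unary relation symbol □ ('box') may occur:
--   Fm false n : formulas of first order arithmetic,
--   Fm true  n : formulas of the language of S_□.

data Term (n : ℕ) : Set where
  var  : Fin n → Term n
  `0   : Term n
  `S   : Term n → Term n
  _`+_ : Term n → Term n → Term n
  _`*_ : Term n → Term n → Term n

infix  7 _≐_
infixr 6 _∧'_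
infixr 5 _∨'_
infixr 4 _⇒'_

data Fm : Bool → ℕ → Set where
  _≐_  : ∀ {b n} → Term n → Term n → Fm b n
  box  : ∀ {n} → Term n → Fm true n
  _∧'_ : ∀ {b n} → Fm b n → Fm b n → Fm b n
  _∨'_ : ∀ {b n} → Fm b n → Fm b n → Fm b n
  _⇒'_ : ∀ {b n} → Fm b n → Fm b n → Fm b n
  ∀'   : ∀ {b n} → Fm b (suc n) → Fm b n
  ∃'   : ∀ {b n} → Fm b (suc n) → Fm b n

⊥' : ∀ {b n} → Fm b n
⊥' = `0 ≐ `S `0

¬' : ∀ {b n} → Fm b n → Fm b n
¬' A = A ⇒' ⊥'

_⇔'_ : ∀ {b n} → Fm b n → Fm b n → Fm b n
A ⇔' B = (A ⇒' B) ∧' (B ⇒' A)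

emb : ∀ {n} → Fm false n → Fm true n
emb (t ≐ u)  = t ≐ u
emb (A ∧' B) = emb A ∧' emb B
emb (A ∨' B) = emb A ∨' emb B
emb (A ⇒' B) = emb A ⇒' emb B
emb (∀' A)   = ∀' (emb A)
emb (∃' A)   = ∃' (emb A)

liftR : ∀ {n m} → (Fin n → Fin m) → Fin (suc n) → Fin (suc m)
liftR ρ fz     = fz
liftR ρ (fs i) = fs (ρ i)

renT : ∀ {n m} → (Fin n → Fin m) → Term n → Term m
renT ρ (var i)  = var (ρ i)
renT ρ `0       = `0
renT ρ (`S t)   = `S (renT ρ t)
renT ρ (t `+ u) = renT ρ t `+ renT ρ u
renT ρ (t `* u) = renT ρ t `* renT ρ u

ren : ∀ {b n m} → (Fin n → Fin m) → Fm b n → Fm b m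
ren ρ (t ≐ u)  = renT ρ t ≐ renT ρ u
ren ρ (box t)  = box (renT ρ t)
ren ρ (A ∧' B) = ren ρ A ∧' ren ρ B
ren ρ (A ∨' B) = ren ρ A ∨' ren ρ B
ren ρ (A ⇒' B) = ren ρ A ⇒' ren ρ B
ren ρ (∀' A)   = ∀' (ren (liftR ρ) A)
ren ρ (∃' A)   = ∃' (ren (liftR ρ) A)

wk : ∀ {b n} → Fm b n → Fm b (suc n)
wk = ren fs

liftS : ∀ {n m} → (Fin n → Term m) → Fin (suc n) → Term (suc m)
liftS σ fz     = var fz
liftS σ (fs i) = renT fs (σ i)

subT : ∀ {n m} → (Fin n → Term m) → Term n → Term m
subT σ (var i)  = σ i
subT σ `0       = `0
subT σ (`S t)   = `S (subT σ t)
subT σ (t `+ u) = subT σ t `+ subT σ u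
subT σ (t `* u) = subT σ t `* subT σ u

sub : ∀ {b n m} → (Fin n → Term m) → Fm b n → Fm b m
sub σ (t ≐ u)  = subT σ t ≐ subT σ u
sub σ (box t)  = box (subT σ t)
sub σ (A ∧' B) = sub σ A ∧' sub σ B
sub σ (A ∨' B) = sub σ A ∨' sub σ B
sub σ (A ⇒' B) = sub σ A ⇒' sub σ B
sub σ (∀' A)   = ∀' (sub (liftS σ) A)
sub σ (∃' A)   = ∃' (sub (liftS σ) A)

-- A(t): substitute t for variable 0 (the other variables shift down)
sub0 : ∀ {b n} → Term n → Fm b (suc n) → Fm b n
sub0 {n = n} t = sub σ
  where
  σ : Fin (suc n) → Term n
  σ fz     = t
  σ (fs i) = var i

-- A(S x): substitute S(var 0) for variable 0, other variables unchanged
subSucc : ∀ {b n} → Fm b (suc n) → Fm b (suc n)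
subSucc {n = n} = sub σ
  where
  σ : Fin (suc n) → Term (suc n)
  σ fz     = `S (var fz)
  σ (fs i) = var (fs i)

num : ∀ {n} → ℕ → Term n
num zero    = `0
num (suc k) = `S (num k)

-- universal closure; variable 0 is bound by the innermost quantifier
∀* : ∀ {b n} → Fm b n → Fm b 0
∀* {n = zero}  A = A
∀* {n = suc n} A = ∀* (∀' A)

pair : ℕ → ℕ → ℕ
pair a b = 2 ^ a * suc (2 * b)

codeT : ∀ {n} → Term n → ℕ
codeT (var i)  = pair 0 (toℕ i)
codeT `0       = pair 1 0
codeT (`S t)   = pair 2 (codeT t)
codeT (t `+ u) = pair 3 (pair (codeT t) (codeT u))
codeT (t `* u) = pair 4 (pair (codeT t) (codeT u))

code : ∀ {n} → Fm true n → ℕ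
code (t ≐ u)  = pair 0 (pair (codeT t) (codeT u))
code (box t)  = pair 1 (codeT t)
code (A ∧' B) = pair 2 (pair (code A) (code B))
code (A ∨' B) = pair 3 (pair (code A) (code B))
code (A ⇒' B) = pair 4 (pair (code A) (code B))
code (∀' A)   = pair 5 (code A)
code (∃' A)   = pair 6 (code A)

-- Truth in the standard model (classical truth, rendered by the
-- double-negation reading of ∨ and ∃), for arithmetic formulas.

eval : ∀ {n} → Term n → Vec ℕ n → ℕ
eval (var i)  ρ = lookup ρ i
eval `0       ρ = 0
eval (`S t)   ρ = suc (eval t ρ)
eval (t `+ u) ρ = eval t ρ + eval u ρ
eval (t `* u) ρ = eval t ρ * eval u ρ

Tr : ∀ {n} → Fm false n → Vec ℕ n → Set
Tr (t ≐ u)  ρ = eval t ρ ≡ eval u ρ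
Tr (A ∧' B) ρ = Tr A ρ × Tr B ρ
Tr (A ∨' B) ρ = ¬ ¬ (Tr A ρ ⊎ Tr B ρ)
Tr (A ⇒' B) ρ = Tr A ρ → Tr B ρ
Tr (∀' A)   ρ = (v : ℕ) → Tr A (v ∷ ρ)
Tr (∃' A)   ρ = ¬ ¬ (Σ ℕ λ v → Tr A (v ∷ ρ))

True : Fm false 0 → Set
True A = Tr A []

data LogAx {b : Bool} : Fm b 0 → Set where
  axK   : ∀ {n} (A B : Fm b n) → LogAx (∀* (A ⇒' (B ⇒' A)))
  axS   : ∀ {n} (A B C : Fm b n) →
          LogAx (∀* ((A ⇒' (B ⇒' C)) ⇒' ((A ⇒' B) ⇒' (A ⇒' C))))
  ∧I    : ∀ {n} (A B : Fm b n) → LogAx (∀* (A ⇒' (B ⇒' (A ∧' B))))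
  ∧E₁   : ∀ {n} (A B : Fm b n) → LogAx (∀* ((A ∧' B) ⇒' A))
  ∧E₂   : ∀ {n} (A B : Fm b n) → LogAx (∀* ((A ∧' B) ⇒' B))
  ∨I₁   : ∀ {n} (A B : Fm b n) → LogAx (∀* (A ⇒' (A ∨' B)))
  ∨I₂   : ∀ {n} (A B : Fm b n) → LogAx (∀* (B ⇒' (A ∨' B)))
  ∨E    : ∀ {n} (A B C : Fm b n) →
          LogAx (∀* ((A ⇒' C) ⇒' ((B ⇒' C) ⇒' ((A ∨' B) ⇒' C))))
  efq   : ∀ {n} (A : Fm b n) → LogAx (∀* (⊥' ⇒' A))
  ∀E    : ∀ {n} (A : Fm b (suc n)) (t : Term n) → LogAx (∀* (∀' A ⇒' sub0 t A))
  ∃I    : ∀ {n} (A : Fm b (suc n)) (t : Term n) → LogAx (∀* (sub0 t A ⇒' ∃' A))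
  eqRefl : ∀ {n} (t : Term n) → LogAx (∀* (t ≐ t))
  eqSubst : ∀ {n} (A : Fm b (suc n)) (t u : Term n) →
          LogAx (∀* ((t ≐ u) ⇒' (sub0 t A ⇒' sub0 u A)))
  -- (∀n1..nk)(A → B) → (∀n2..nk)(A → (∀n1)B), n1 not free in A
  gen∀  : ∀ {n} (A : Fm b n) (B : Fm b (suc n)) →
          LogAx (∀* (wk A ⇒' B) ⇒' ∀* (A ⇒' ∀' B))
  -- (∀n1..nk)(A → B) → (∀n2..nk)((∃n1)A → B), n1 not free in B
  gen∃  : ∀ {n} (A : Fm b (suc n)) (B : Fm b n) →
          LogAx (∀* (A ⇒' wk B) ⇒' ∀* (∃' A ⇒' B))

data IndAx {b : Bool} : Fm b 0 → Set where
  ind : ∀ {n} (A : Fm b (suc n)) →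
        IndAx (∀* (sub0 `0 A ⇒' (∀' (A ⇒' subSucc A) ⇒' ∀' A)))

data Deriv {b : Bool} (Γ : Fm b 0 → Set) : Fm b 0 → Set where
  nonlog : ∀ {A} → Γ A → Deriv Γ A
  logic  : ∀ {A} → LogAx A → Deriv Γ A
  mp     : ∀ {n} (A B : Fm b n) →
           Deriv Γ (∀* A) → Deriv Γ (∀* (A ⇒' B)) → Deriv Γ (∀* B)

-- Peano arithmetic (classical: includes excluded middle instances)

x₀ x₁ : ∀ {n} → Term (suc (suc n))
x₀ = var fz
x₁ = var (fs fz)

data PAAx : Fm false 0 → Set where
  succ≠0  : PAAx (∀' (¬' (`S (var fz) ≐ `0)))
  succInj : PAAx (∀' (∀' ((`S x₁ ≐ `S x₀) ⇒' (x₁ ≐ x₀))))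
  plus0   : PAAx (∀' ((var fz `+ `0) ≐ var fz))
  plusS   : PAAx (∀' (∀' ((x₁ `+ `S x₀) ≐ `S (x₁ `+ x₀))))
  times0  : PAAx (∀' ((var fz `* `0) ≐ `0))
  timesS  : PAAx (∀' (∀' ((x₁ `* `S x₀) ≐ ((x₁ `* x₀) `+ x₁))))
  induct  : ∀ {A} → IndAx A → PAAx A
  lem     : ∀ {n} (A : Fm false n) → PAAx (∀* (A ∨' ¬' A))

-- Sb : an arithmetical formula with free variables 0,1,2 (read c, v, d)
-- arithmetizing substitution of a numeral: Sb(c, v, d) says that d is the
-- Gödel number of B(v̄) when c is the Gödel number of B(x0, ...).

module SBox (SAx : Fm false 0 → Set) (Sb : Fm false 3) (AxF : Fm false 1) where

  -- G n : free variables 0 = a code c, 1..n = x0..x(n-1); expresses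
  -- □ of the code obtained from c by substituting the numerals x̄0..x̄(n-1)
  G : (n : ℕ) → Fm true (suc n)
  G zero    = box (var fz)
  G (suc n) = ∃' (ren ρ (emb Sb) ∧' ren τ (G n))
    where
    ρ : Fin 3 → Fin (suc (suc (suc n)))
    ρ fz           = fs fz
    ρ (fs fz)      = fs (fs fz)
    ρ (fs (fs _))  = fz
    τ : Fin (suc n) → Fin (suc (suc (suc n)))
    τ fz     = fz
    τ (fs i) = fs (fs (fs i))

  -- □⌜A(n̄1,…,n̄k)⌝ for a formula A with free variables n1..nk
  □⌜_⌝ : ∀ {n} → Fm true n → Fm true n
  □⌜ A ⌝ = sub0 (num (code A)) (G _)

  □^ : ℕ → Fm true 0 → Fm true 0
  □^ zero    A = A
  □^ (suc k) A = □⌜ □^ k A ⌝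

  data MainAx : Fm true 0 → Set where
    fromS   : ∀ {A} → SAx A → MainAx (emb A)
    induct  : ∀ {A} → IndAx A → MainAx A
    logical : ∀ {A} → LogAx A → MainAx A
    ax1 : ∀ {n} (A B : Fm true n) → MainAx (∀* (□⌜ A ∨' B ⌝ ⇔' (□⌜ A ⌝ ∨' □⌜ B ⌝)))
    ax2 : ∀ {n} (A B : Fm true n) → MainAx (∀* (□⌜ A ∧' B ⌝ ⇔' (□⌜ A ⌝ ∧' □⌜ B ⌝)))
    ax3 : ∀ {n} (A : Fm true (suc n)) → MainAx (∀* (∃' □⌜ A ⌝ ⇒' □⌜ ∃' A ⌝))
    ax4 : ∀ {n} (A : Fm true (suc n)) → MainAx (∀* (□⌜ ∀' A ⌝ ⇔' ∀' □⌜ A ⌝))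
    ax5 : ∀ {n} (A B : Fm true n) → MainAx (∀* (□⌜ A ⇒' B ⌝ ⇒' (□⌜ A ⌝ ⇒' □⌜ B ⌝)))
    ax6 : ∀ {n} (A : Fm true n) → MainAx (∀* (A ⇒' □⌜ A ⌝))

  jump : Fm true 0
  jump = ∀' (emb AxF ⇒' box (var fz))

  data SBoxAx : Fm true 0 → Set where
    main    : ∀ {A} → MainAx A → SBoxAx A
    jumpAx  : SBoxAx jump

  ThmSBox : Fm true 0 → Set
  ThmSBox = Deriv SBoxAx

  SbCorrect : Set
  SbCorrect = ∀ {m} (B : Fm true (suc m)) (v d : ℕ) →
    Tr Sb (code B ∷ v ∷ d ∷ []) ⇔ (d ≡ code (sub0 (num v) B))

  AxCorrect : Set
  AxCorrect = ∀ (g : ℕ) →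
    Tr AxF (g ∷ []) ⇔ Σ (Fm true 0) (λ B → MainAx B × code B ≡ g)

  AxPAProvable : Set
  AxPAProvable = ∀ (g : ℕ) → Tr AxF (g ∷ []) → Deriv PAAx (sub0 (num g) AxF)

-- Read □ at a depth d: at depth 0 every □-formula holds, and at depth d + 1
-- □(c) holds iff c codes a sentence that holds at depth d.  An implication
-- holds at depth d iff it holds at every depth ≤ d, so that truth at depth
-- d + 1 implies truth at depth d; this is what makes the capture axiom
-- A → □⌜A⌝ sound.  Arithmetic formulas mean the same at every depth, namely
-- truth in the standard model, so the axioms of S hold by soundness of S,
-- and the jump axiom holds at depth d + 1 because every main axiom holds at
-- depth d.  Hence every theorem of S_□ holds at every depth, while
-- □^k⌜A⌝ at depth k unfolds to A at depth 0, i.e. to the truth of A.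
module Submission where

open import Defs
open import Data.Bool using (true; false)
open import Data.Empty using (⊥-elim)
open import Data.Fin using (Fin; toℕ) renaming (zero to fz; suc to fs)
open import Data.Fin.Properties using (toℕ-injective)
open import Data.Nat using (ℕ; zero; suc; _+_; _*_; _^_; _≤_; _≤′_; ≤′-refl; ≤′-step; _≟_)
open import Data.Nat.Induction using (rec)
open import Data.Nat.Properties
  using (≤′-trans; *-cancelˡ-≡; *-assoc; *-identityˡ; suc-injective; even≢odd)
open import Data.Product using (Σ; _×_; _,_; proj₁; proj₂; map₁)
open import Data.Product.Function.Dependent.Propositional using (Σ-⇔)
open import Data.Product.Function.NonDependent.Propositional using (_×-⇔_)
open import Data.Sum using (_⊎_; inj₁; inj₂)
import Data.Sum as Sum
open import Data.Sum.Function.Propositional using (_⊎-⇔_)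
open import Data.Unit using (⊤; tt)
open import Data.Vec using (Vec; []; _∷_; lookup)
open import Function using (_∘_; id)
open import Function.Bundles using (_⇔_; mk⇔; Equivalence)
open import Function.Construct.Composition using (_⇔-∘_)
open import Function.Construct.Identity using (⇔-id; ↠-id)
open import Function.Related.TypeIsomorphisms using (→-cong-⇔; ¬-cong-⇔)
open import Relation.Binary.PropositionalEquality using (_≡_; refl; sym; trans; cong; cong₂; subst)
open import Relation.Nullary using (¬_; Dec)
open import Relation.Nullary.Decidable using (decidable-stable)
open import Relation.Nullary.Negation using (Stable; negated-stable; ¬¬-map)

open Equivalence using (to; from)

¬¬-cong-⇔ : ∀ {P Q : Set} → P ⇔ Q → (¬ ¬ P) ⇔ (¬ ¬ Q)
¬¬-cong-⇔ = ¬-cong-⇔ ∘ ¬-cong-⇔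

Π-cong-⇔ : ∀ {P Q : ℕ → Set} → (∀ v → P v ⇔ Q v) → ((v : ℕ) → P v) ⇔ ((v : ℕ) → Q v)
Π-cong-⇔ e = mk⇔ (λ f v → to (e v) (f v)) (λ f v → from (e v) (f v))

∃-cong-⇔ : ∀ {P Q : ℕ → Set} → (∀ v → P v ⇔ Q v) → Σ ℕ P ⇔ Σ ℕ Q
∃-cong-⇔ e = Σ-⇔ (↠-id ℕ) (e _)

¬¬-one-point : ∀ {X Y : Set} {f : X → Y} {P : X → Set} {c : X} →
  (∀ {x} → f x ≡ f c → x ≡ c) → Stable (P c) →
  (¬ ¬ Σ X λ x → f x ≡ f c × P x) ⇔ P c
¬¬-one-point {P = P} f-inj stable =
  mk⇔ (λ h → stable (¬¬-map (λ (x , fx≡fc , p) → subst P (f-inj fx≡fc) p) h))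
      (λ p k → k (_ , refl , p))

-- Implication is read "at depth d and, recursively, at every smaller
-- depth", which keeps the definition structural in (d, A).
mutual
  Assertible : ℕ → ℕ → Set
  Assertible zero    c = ⊤
  Assertible (suc d) c = ¬ ¬ Σ (Fm true 0) λ C → code C ≡ c × Sat d C []

  Sat : ∀ {n} → ℕ → Fm true n → Vec ℕ n → Set
  Sat d       (t ≐ u)  ρ = eval t ρ ≡ eval u ρ
  Sat d       (box t)  ρ = Assertible d (eval t ρ)
  Sat d       (A ∧' B) ρ = Sat d A ρ × Sat d B ρ
  Sat d       (A ∨' B) ρ = ¬ ¬ (Sat d A ρ ⊎ Sat d B ρ)
  Sat zero    (A ⇒' B) ρ = Sat zero A ρ → Sat zero B ρ
  Sat (suc d) (A ⇒' B) ρ = (Sat (suc d) A ρ → Sat (suc d) B ρ) × Sat d (A ⇒' B) ρ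
  Sat d       (∀' A)   ρ = (v : ℕ) → Sat d A (v ∷ ρ)
  Sat d       (∃' A)   ρ = ¬ ¬ Σ ℕ λ v → Sat d A (v ∷ ρ)

Assertible-stable : ∀ d c → Stable (Assertible d c)
Assertible-stable zero    c _ = tt
Assertible-stable (suc d) c   = negated-stable

Sat-stable : ∀ {n} d (A : Fm true n) ρ → Stable (Sat d A ρ)
Sat-stable d       (t ≐ u)  ρ   = decidable-stable (eval t ρ ≟ eval u ρ)
Sat-stable d       (box t)  ρ   = Assertible-stable d (eval t ρ)
Sat-stable d       (A ∧' B) ρ h =
  Sat-stable d A ρ (¬¬-map proj₁ h) , Sat-stable d B ρ (¬¬-map proj₂ h)
Sat-stable d       (A ∨' B) ρ   = negated-stable
Sat-stable zero    (A ⇒' B) ρ h = λ a → Sat-stable zero B ρ (¬¬-map (λ f → f a) h)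
Sat-stable (suc d) (A ⇒' B) ρ h =
  (λ a → Sat-stable (suc d) B ρ (¬¬-map (λ f → proj₁ f a) h)) ,
  Sat-stable d (A ⇒' B) ρ (¬¬-map proj₂ h)
Sat-stable d       (∀' A)   ρ h = λ v → Sat-stable d A (v ∷ ρ) (¬¬-map (λ f → f v) h)
Sat-stable d       (∃' A)   ρ   = negated-stable

mutual
  Assertible-pred : ∀ d c → Assertible (suc d) c → Assertible d c
  Assertible-pred zero    c _ = tt
  Assertible-pred (suc d) c   = ¬¬-map λ (C , code≡c , sat) → C , code≡c , Sat-pred d C [] sat

  Sat-pred : ∀ {n} d (A : Fm true n) ρ → Sat (suc d) A ρ → Sat d A ρ
  Sat-pred d (t ≐ u)  ρ         = id
  Sat-pred d (box t)  ρ         = Assertible-pred d (eval t ρ)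
  Sat-pred d (A ∧' B) ρ (a , b) = Sat-pred d A ρ a , Sat-pred d B ρ b
  Sat-pred d (A ∨' B) ρ         = ¬¬-map (Sum.map (Sat-pred d A ρ) (Sat-pred d B ρ))
  Sat-pred d (A ⇒' B) ρ         = proj₂
  Sat-pred d (∀' A)   ρ f v     = Sat-pred d A (v ∷ ρ) (f v)
  Sat-pred d (∃' A)   ρ         = ¬¬-map λ (v , a) → v , Sat-pred d A (v ∷ ρ) a

Sat-antitone : ∀ {n d e} (A : Fm true n) {ρ} → e ≤′ d → Sat d A ρ → Sat e A ρ
Sat-antitone A ≤′-refl sat = sat
Sat-antitone {d = suc d} A {ρ} (≤′-step e≤d) sat = Sat-antitone A e≤d (Sat-pred d A ρ sat)

⇒-intro : ∀ {n} d {A B : Fm true n} {ρ} →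
  (∀ e → e ≤′ d → Sat e A ρ → Sat e B ρ) → Sat d (A ⇒' B) ρ
⇒-intro zero    f = f zero ≤′-refl
⇒-intro (suc d) f = f (suc d) ≤′-refl , ⇒-intro d (λ e → f e ∘ ≤′-step)

⇒-elim : ∀ {n} d {A B : Fm true n} {ρ} → Sat d (A ⇒' B) ρ → Sat d A ρ → Sat d B ρ
⇒-elim zero    f = f
⇒-elim (suc d) f = proj₁ f

⇒-elim-≤′ : ∀ {n e d} {A B : Fm true n} {ρ} →
  e ≤′ d → Sat d (A ⇒' B) ρ → Sat e A ρ → Sat e B ρ
⇒-elim-≤′ {e = e} {A = A} {B} e≤d f = ⇒-elim e (Sat-antitone (A ⇒' B) e≤d f)

eval-subT : ∀ {n m} (σ : Fin n → Term m) (t : Term n) {ρ : Vec ℕ m} {ρ' : Vec ℕ n} →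
  (∀ i → eval (σ i) ρ ≡ lookup ρ' i) → eval (subT σ t) ρ ≡ eval t ρ'
eval-subT σ (var i)  h = h i
eval-subT σ `0       h = refl
eval-subT σ (`S t)   h = cong suc (eval-subT σ t h)
eval-subT σ (t `+ u) h = cong₂ _+_ (eval-subT σ t h) (eval-subT σ u h)
eval-subT σ (t `* u) h = cong₂ _*_ (eval-subT σ t h) (eval-subT σ u h)

eval-num : ∀ {n} v (ρ : Vec ℕ n) → eval (num v) ρ ≡ v
eval-num zero    ρ = refl
eval-num (suc v) ρ = cong suc (eval-num v ρ)

renT≡subT : ∀ {n m} (r : Fin n → Fin m) {σ : Fin n → Term m} →
  (∀ i → var (r i) ≡ σ i) → ∀ t → renT r t ≡ subT σ t
renT≡subT r h (var i)  = h i
renT≡subT r h `0       = refl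
renT≡subT r h (`S t)   = cong `S (renT≡subT r h t)
renT≡subT r h (t `+ u) = cong₂ _`+_ (renT≡subT r h t) (renT≡subT r h u)
renT≡subT r h (t `* u) = cong₂ _`*_ (renT≡subT r h t) (renT≡subT r h u)

liftR≡liftS : ∀ {n m} (r : Fin n → Fin m) {σ : Fin n → Term m} →
  (∀ i → var (r i) ≡ σ i) → ∀ i → var (liftR r i) ≡ liftS σ i
liftR≡liftS r h fz     = refl
liftR≡liftS r h (fs i) = cong (renT fs) (h i)

ren≡sub : ∀ {b n m} (r : Fin n → Fin m) {σ : Fin n → Term m} →
  (∀ i → var (r i) ≡ σ i) → (A : Fm b n) → ren r A ≡ sub σ A
ren≡sub r h (t ≐ u)  = cong₂ _≐_ (renT≡subT r h t) (renT≡subT r h u)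
ren≡sub r h (box t)  = cong box (renT≡subT r h t)
ren≡sub r h (A ∧' B) = cong₂ _∧'_ (ren≡sub r h A) (ren≡sub r h B)
ren≡sub r h (A ∨' B) = cong₂ _∨'_ (ren≡sub r h A) (ren≡sub r h B)
ren≡sub r h (A ⇒' B) = cong₂ _⇒'_ (ren≡sub r h A) (ren≡sub r h B)
ren≡sub r h (∀' A)   = cong ∀' (ren≡sub (liftR r) (liftR≡liftS r h) A)
ren≡sub r h (∃' A)   = cong ∃' (ren≡sub (liftR r) (liftR≡liftS r h) A)

eval-liftS : ∀ {n m} (σ : Fin n → Term m) {ρ : Vec ℕ m} {ρ' : Vec ℕ n} →
  (∀ i → eval (σ i) ρ ≡ lookup ρ' i) →
  ∀ v i → eval (liftS σ i) (v ∷ ρ) ≡ lookup (v ∷ ρ') i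
eval-liftS σ h v fz     = refl
eval-liftS σ h v (fs i) = trans (eval-wk (σ i)) (h i)
  where
  eval-wk : ∀ {n} (t : Term n) {ρ : Vec ℕ n} → eval (renT fs t) (v ∷ ρ) ≡ eval t ρ
  eval-wk t = trans (cong (λ s → eval s _) (renT≡subT fs {var ∘ fs} (λ _ → refl) t))
                    (eval-subT (var ∘ fs) t (λ _ → refl))

Sat-sub : ∀ {n m} d (A : Fm true n) (σ : Fin n → Term m) {ρ : Vec ℕ m} {ρ' : Vec ℕ n} →
  (∀ i → eval (σ i) ρ ≡ lookup ρ' i) → Sat d (sub σ A) ρ ⇔ Sat d A ρ'
Sat-sub d       (t ≐ u)  σ h rewrite eval-subT σ t h | eval-subT σ u h = ⇔-id _
Sat-sub d       (box t)  σ h rewrite eval-subT σ t h = ⇔-id _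
Sat-sub d       (A ∧' B) σ h = Sat-sub d A σ h ×-⇔ Sat-sub d B σ h
Sat-sub d       (A ∨' B) σ h = ¬¬-cong-⇔ (Sat-sub d A σ h ⊎-⇔ Sat-sub d B σ h)
Sat-sub zero    (A ⇒' B) σ h = →-cong-⇔ (Sat-sub zero A σ h) (Sat-sub zero B σ h)
Sat-sub (suc d) (A ⇒' B) σ h =
  →-cong-⇔ (Sat-sub (suc d) A σ h) (Sat-sub (suc d) B σ h) ×-⇔ Sat-sub d (A ⇒' B) σ h
Sat-sub d       (∀' A)   σ h = Π-cong-⇔ λ v → Sat-sub d A (liftS σ) (eval-liftS σ h v)
Sat-sub d       (∃' A)   σ h =
  ¬¬-cong-⇔ (∃-cong-⇔ λ v → Sat-sub d A (liftS σ) (eval-liftS σ h v))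

Sat-ren : ∀ {n m} d (A : Fm true n) (r : Fin n → Fin m) {ρ : Vec ℕ m} {ρ' : Vec ℕ n} →
  (∀ i → lookup ρ (r i) ≡ lookup ρ' i) → Sat d (ren r A) ρ ⇔ Sat d A ρ'
Sat-ren d A r h =
  subst (λ X → Sat d X _ ⇔ Sat d A _) (sym (ren≡sub r (λ _ → refl) A)) (Sat-sub d A (var ∘ r) h)

Sat-wk : ∀ {n} d (A : Fm true n) ρ v → Sat d (wk A) (v ∷ ρ) ⇔ Sat d A ρ
Sat-wk d A ρ v = Sat-ren d A fs (λ _ → refl)

Sat-sub0 : ∀ {n} d (A : Fm true (suc n)) (t : Term n) ρ {w} →
  eval t ρ ≡ w → Sat d (sub0 t A) ρ ⇔ Sat d A (w ∷ ρ)
Sat-sub0 d A t ρ t≡w = Sat-sub d A _ λ { fz → t≡w ; (fs i) → refl }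

Sat-subSucc : ∀ {n} d (A : Fm true (suc n)) ρ v → Sat d (subSucc A) (v ∷ ρ) ⇔ Sat d A (suc v ∷ ρ)
Sat-subSucc d A ρ v = Sat-sub d A _ λ { fz → refl ; (fs i) → refl }

Sat-emb : ∀ {n} d (A : Fm false n) ρ → Sat d (emb A) ρ ⇔ Tr A ρ
Sat-emb d       (t ≐ u)  ρ = ⇔-id _
Sat-emb d       (A ∧' B) ρ = Sat-emb d A ρ ×-⇔ Sat-emb d B ρ
Sat-emb d       (A ∨' B) ρ = ¬¬-cong-⇔ (Sat-emb d A ρ ⊎-⇔ Sat-emb d B ρ)
Sat-emb zero    (A ⇒' B) ρ = →-cong-⇔ (Sat-emb zero A ρ) (Sat-emb zero B ρ)
Sat-emb (suc d) (A ⇒' B) ρ =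
  mk⇔ (to A⇒B ∘ proj₁) (λ f → from A⇒B f , from (Sat-emb d (A ⇒' B) ρ) f)
  where A⇒B = →-cong-⇔ (Sat-emb (suc d) A ρ) (Sat-emb (suc d) B ρ)
Sat-emb d       (∀' A)   ρ = Π-cong-⇔ λ v → Sat-emb d A (v ∷ ρ)
Sat-emb d       (∃' A)   ρ = ¬¬-cong-⇔ (∃-cong-⇔ λ v → Sat-emb d A (v ∷ ρ))

Sat-∀* : ∀ {n} d (A : Fm true n) → Sat d (∀* A) [] ⇔ ((ρ : Vec ℕ n) → Sat d A ρ)
Sat-∀* {zero}  d A = mk⇔ (λ { sat [] → sat }) (λ f → f [])
Sat-∀* {suc n} d A = mk⇔ (λ { sat (v ∷ ρ) → to (Sat-∀* d (∀' A)) sat ρ v })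
                         (λ f → from (Sat-∀* d (∀' A)) λ ρ v → f (v ∷ ρ))

-- inst ρ A is the sentence A(ρ̄) whose code □⌜ A ⌝ asserts under ρ.
inst : ∀ {n} → Vec ℕ n → Fm true n → Fm true 0
inst []      A = A
inst (v ∷ ρ) A = inst ρ (sub0 (num v) A)

Sat-inst : ∀ {n} d (A : Fm true n) ρ → Sat d (inst ρ A) [] ⇔ Sat d A ρ
Sat-inst d A []      = ⇔-id _
Sat-inst d A (v ∷ ρ) = Sat-sub0 d A (num v) ρ (eval-num v ρ) ⇔-∘ Sat-inst d (sub0 (num v) A) ρ

pair-zero : ∀ b → pair 0 b ≡ suc (2 * b)
pair-zero b = *-identityˡ _

pair-suc : ∀ a b → pair (suc a) b ≡ 2 * pair a b
pair-suc a b = *-assoc 2 (2 ^ a) _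

pair-injective : ∀ a b a' b' → pair a b ≡ pair a' b' → a ≡ a' × b ≡ b'
pair-injective zero b zero b' e =
  refl , *-cancelˡ-≡ b b' 2 (suc-injective (trans (sym (pair-zero b)) (trans e (pair-zero b'))))
pair-injective zero b (suc a') b' e =
  ⊥-elim (even≢odd (pair a' b') b (trans (sym (pair-suc a' b')) (trans (sym e) (pair-zero b))))
pair-injective (suc a) b zero b' e =
  ⊥-elim (even≢odd (pair a b) b' (trans (sym (pair-suc a b)) (trans e (pair-zero b'))))
pair-injective (suc a) b (suc a') b' e =
  map₁ (cong suc) (pair-injective a b a' b'
    (*-cancelˡ-≡ _ _ 2 (trans (sym (pair-suc a b)) (trans e (pair-suc a' b')))))

tagT argsT : ∀ {n} → Term n → ℕ
tagT (var i)  = 0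
tagT `0       = 1
tagT (`S t)   = 2
tagT (t `+ u) = 3
tagT (t `* u) = 4
argsT (var i)  = toℕ i
argsT `0       = 0
argsT (`S t)   = codeT t
argsT (t `+ u) = pair (codeT t) (codeT u)
argsT (t `* u) = pair (codeT t) (codeT u)

codeT-tagged : ∀ {n} (t : Term n) → codeT t ≡ pair (tagT t) (argsT t)
codeT-tagged (var i)  = refl
codeT-tagged `0       = refl
codeT-tagged (`S t)   = refl
codeT-tagged (t `+ u) = refl
codeT-tagged (t `* u) = refl

mutual
  codeT-injective : ∀ {n} {t u : Term n} → codeT t ≡ codeT u → t ≡ u
  codeT-injective {t = t} {u} e =
    let tag≡ , args≡ = pair-injective _ _ _ _ (trans (sym (codeT-tagged t)) (trans e (codeT-tagged u)))
    in same-tagT t u tag≡ args≡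

  same-tagT : ∀ {n} (t u : Term n) → tagT t ≡ tagT u → argsT t ≡ argsT u → t ≡ u
  same-tagT (var i)  (var j)    refl e = cong var (toℕ-injective e)
  same-tagT `0       `0         refl e = refl
  same-tagT (`S t)   (`S u)     refl e = cong `S (codeT-injective e)
  same-tagT (t `+ u) (t' `+ u') refl e =
    let e₁ , e₂ = pair-injective _ _ _ _ e in cong₂ _`+_ (codeT-injective e₁) (codeT-injective e₂)
  same-tagT (t `* u) (t' `* u') refl e =
    let e₁ , e₂ = pair-injective _ _ _ _ e in cong₂ _`*_ (codeT-injective e₁) (codeT-injective e₂)

tag args : ∀ {n} → Fm true n → ℕ
tag (t ≐ u)  = 0
tag (box t)  = 1
tag (A ∧' B) = 2
tag (A ∨' B) = 3
tag (A ⇒' B) = 4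
tag (∀' A)   = 5
tag (∃' A)   = 6
args (t ≐ u)  = pair (codeT t) (codeT u)
args (box t)  = codeT t
args (A ∧' B) = pair (code A) (code B)
args (A ∨' B) = pair (code A) (code B)
args (A ⇒' B) = pair (code A) (code B)
args (∀' A)   = code A
args (∃' A)   = code A

code-tagged : ∀ {n} (A : Fm true n) → code A ≡ pair (tag A) (args A)
code-tagged (t ≐ u)  = refl
code-tagged (box t)  = refl
code-tagged (A ∧' B) = refl
code-tagged (A ∨' B) = refl
code-tagged (A ⇒' B) = refl
code-tagged (∀' A)   = refl
code-tagged (∃' A)   = refl

mutual
  code-injective : ∀ {n} {A B : Fm true n} → code A ≡ code B → A ≡ B
  code-injective {A = A} {B} e =
    let tag≡ , args≡ = pair-injective _ _ _ _ (trans (sym (code-tagged A)) (trans e (code-tagged B)))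
    in same-tag A B tag≡ args≡

  same-tag : ∀ {n} (A B : Fm true n) → tag A ≡ tag B → args A ≡ args B → A ≡ B
  same-tag (t ≐ u)  (t' ≐ u')  refl e =
    let e₁ , e₂ = pair-injective _ _ _ _ e in cong₂ _≐_ (codeT-injective e₁) (codeT-injective e₂)
  same-tag (box t)  (box u)    refl e = cong box (codeT-injective e)
  same-tag (A ∧' B) (A' ∧' B') refl e =
    let e₁ , e₂ = pair-injective _ _ _ _ e in cong₂ _∧'_ (code-injective e₁) (code-injective e₂)
  same-tag (A ∨' B) (A' ∨' B') refl e =
    let e₁ , e₂ = pair-injective _ _ _ _ e in cong₂ _∨'_ (code-injective e₁) (code-injective e₂)
  same-tag (A ⇒' B) (A' ⇒' B') refl e =
    let e₁ , e₂ = pair-injective _ _ _ _ e in cong₂ _⇒'_ (code-injective e₁) (code-injective e₂)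
  same-tag (∀' A)   (∀' B)     refl e = cong ∀' (code-injective e)
  same-tag (∃' A)   (∃' B)     refl e = cong ∃' (code-injective e)

Assertible-code : ∀ d (C : Fm true 0) → Assertible (suc d) (code C) ⇔ Sat d C []
Assertible-code d C = ¬¬-one-point {c = C} code-injective (Sat-stable d C [])

Valid : Fm true 0 → Set
Valid B = ∀ d → Sat d B []

valid-∀* : ∀ {n} (A : Fm true n) → (∀ d ρ → Sat d A ρ) → Valid (∀* A)
valid-∀* A valid d = from (Sat-∀* d A) (valid d)

LogAx-valid : ∀ {B} → LogAx {true} B → Valid B
LogAx-valid (axK A B) = valid-∀* (A ⇒' (B ⇒' A)) λ d ρ →
  ⇒-intro d λ e _ a → ⇒-intro e λ e' e'≤e _ → Sat-antitone A e'≤e a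
LogAx-valid (axS A B C) = valid-∀* ((A ⇒' (B ⇒' C)) ⇒' ((A ⇒' B) ⇒' (A ⇒' C))) λ d ρ →
  ⇒-intro d λ e _ f → ⇒-intro e λ e' e'≤e g → ⇒-intro e' λ e'' e''≤e' a →
    ⇒-elim e'' {B} {C} (⇒-elim-≤′ {A = A} {B ⇒' C} (≤′-trans e''≤e' e'≤e) f a)
                       (⇒-elim-≤′ {A = A} {B} e''≤e' g a)
LogAx-valid (∧I A B) = valid-∀* (A ⇒' (B ⇒' (A ∧' B))) λ d ρ →
  ⇒-intro d λ e _ a → ⇒-intro e λ e' e'≤e b → Sat-antitone A e'≤e a , b
LogAx-valid (∧E₁ A B) = valid-∀* ((A ∧' B) ⇒' A) λ d ρ → ⇒-intro d λ _ _ → proj₁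
LogAx-valid (∧E₂ A B) = valid-∀* ((A ∧' B) ⇒' B) λ d ρ → ⇒-intro d λ _ _ → proj₂
LogAx-valid (∨I₁ A B) = valid-∀* (A ⇒' (A ∨' B)) λ d ρ → ⇒-intro d λ _ _ a k → k (inj₁ a)
LogAx-valid (∨I₂ A B) = valid-∀* (B ⇒' (A ∨' B)) λ d ρ → ⇒-intro d λ _ _ b k → k (inj₂ b)
LogAx-valid (∨E A B C) = valid-∀* ((A ⇒' C) ⇒' ((B ⇒' C) ⇒' ((A ∨' B) ⇒' C))) λ d ρ →
  ⇒-intro d λ e _ f → ⇒-intro e λ e' e'≤e g → ⇒-intro e' λ e'' e''≤e' a∨b →
    Sat-stable e'' C ρ (¬¬-map (Sum.[ ⇒-elim-≤′ {A = A} {C} (≤′-trans e''≤e' e'≤e) f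
                                    , ⇒-elim-≤′ {A = B} {C} e''≤e' g ]) a∨b)
LogAx-valid (efq A) = valid-∀* (⊥' ⇒' A) λ d ρ → ⇒-intro d λ _ _ ()
LogAx-valid (∀E A t) = valid-∀* (∀' A ⇒' sub0 t A) λ d ρ →
  ⇒-intro d λ e _ ∀A → from (Sat-sub0 e A t ρ refl) (∀A (eval t ρ))
LogAx-valid (∃I A t) = valid-∀* (sub0 t A ⇒' ∃' A) λ d ρ →
  ⇒-intro d λ e _ At k → k (eval t ρ , to (Sat-sub0 e A t ρ refl) At)
LogAx-valid (eqRefl t) = valid-∀* (t ≐ t) λ _ _ → refl
LogAx-valid (eqSubst A t u) = valid-∀* ((t ≐ u) ⇒' (sub0 t A ⇒' sub0 u A)) λ d ρ →
  ⇒-intro d λ e _ t≡u → ⇒-intro e λ e' _ At →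
    from (Sat-sub0 e' A u ρ refl)
         (subst (λ w → Sat e' A (w ∷ ρ)) t≡u (to (Sat-sub0 e' A t ρ refl) At))
LogAx-valid (gen∀ A B) d = ⇒-intro d λ e _ hyp → from (Sat-∀* e (A ⇒' ∀' B)) λ ρ →
  ⇒-intro e λ e' e'≤e a v →
    ⇒-elim-≤′ {A = wk A} {B} e'≤e (to (Sat-∀* e (wk A ⇒' B)) hyp (v ∷ ρ))
                                   (from (Sat-wk e' A ρ v) a)
LogAx-valid (gen∃ A B) d = ⇒-intro d λ e _ hyp → from (Sat-∀* e (∃' A ⇒' B)) λ ρ →
  ⇒-intro e λ e' e'≤e ∃A → Sat-stable e' B ρ (¬¬-map (λ (v , a) → to (Sat-wk e' B ρ v)
    (⇒-elim-≤′ {A = A} {wk B} e'≤e (to (Sat-∀* e (A ⇒' wk B)) hyp (v ∷ ρ)) a)) ∃A)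

IndAx-valid : ∀ {B} → IndAx {true} B → Valid B
IndAx-valid (ind A) = valid-∀* (sub0 `0 A ⇒' (∀' (A ⇒' subSucc A) ⇒' ∀' A)) λ d ρ →
  ⇒-intro d λ e _ base → ⇒-intro e λ e' e'≤e step →
    rec (λ v → Sat e' A (v ∷ ρ))
      λ { zero    _  → Sat-antitone A e'≤e (to (Sat-sub0 e A `0 ρ refl) base)
        ; (suc v) ih → to (Sat-subSucc e' A ρ v) (⇒-elim e' (step v) ih) }

module Soundness (SAx : Fm false 0 → Set) (Sb : Fm false 3) (AxF : Fm false 1)
  (Sb-correct : SBox.SbCorrect SAx Sb AxF) (Ax-correct : SBox.AxCorrect SAx Sb AxF)
  (S-sound : (A : Fm false 0) → SAx A → True A) where

  open SBox SAx Sb AxF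

  Sat-Sb : ∀ {k m} d (r : Fin 3 → Fin m) {ρ : Vec ℕ m} (B : Fm true (suc k)) v e →
    (∀ i → lookup ρ (r i) ≡ lookup (code B ∷ v ∷ e ∷ []) i) →
    Sat d (ren r (emb Sb)) ρ ⇔ (e ≡ code (sub0 (num v) B))
  Sat-Sb d r B v e h = Sb-correct B v e ⇔-∘ (Sat-emb d Sb _ ⇔-∘ Sat-ren d (emb Sb) r h)

  -- By Sb-correct, the witness bound in G (suc n) can only be the code of B(v̄).
  Sat-G : ∀ d n (B : Fm true n) ρ → Sat d (G n) (code B ∷ ρ) ⇔ Assertible d (code (inst ρ B))
  Sat-G d zero    B []      = ⇔-id _
  Sat-G d (suc n) B (v ∷ ρ) =
    Sat-G d n (sub0 (num v) B) ρ
      ⇔-∘ (¬¬-one-point id (Sat-stable d (G n) _)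
      ⇔-∘ ¬¬-cong-⇔ (∃-cong-⇔ λ e →
            Sat-Sb d _ B v e (λ { fz → refl ; (fs fz) → refl ; (fs (fs fz)) → refl })
              ×-⇔ Sat-ren d (G n) _ {ρ' = e ∷ ρ} (λ { fz → refl ; (fs i) → refl })))

  Sat-□⌜⌝ : ∀ {n} d (A : Fm true n) ρ → Sat d □⌜ A ⌝ ρ ⇔ Assertible d (code (inst ρ A))
  Sat-□⌜⌝ d A ρ = Sat-G d _ A ρ ⇔-∘ Sat-sub0 d (G _) (num (code A)) ρ (eval-num (code A) ρ)

  Sat-□-zero : ∀ {n} (A : Fm true n) ρ → Sat zero □⌜ A ⌝ ρ
  Sat-□-zero A ρ = from (Sat-□⌜⌝ zero A ρ) tt

  Sat-□-suc : ∀ {n} d (A : Fm true n) ρ → Sat (suc d) □⌜ A ⌝ ρ ⇔ Sat d A ρ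
  Sat-□-suc d A ρ = Sat-inst d A ρ ⇔-∘ (Assertible-code d (inst ρ A) ⇔-∘ Sat-□⌜⌝ (suc d) A ρ)

  ⇒□-intro : ∀ {n} d (A B : Fm true n) ρ →
    (∀ e → suc e ≤′ d → Sat (suc e) A ρ → Sat e B ρ) → Sat d (A ⇒' □⌜ B ⌝) ρ
  ⇒□-intro d A B ρ f = ⇒-intro d λ
    { zero    _   _ → Sat-□-zero B ρ
    ; (suc e) e<d a → from (Sat-□-suc e B ρ) (f e e<d a) }

  MainAx-valid : ∀ {B} → MainAx B → Valid B
  MainAx-valid (fromS {A} s) d = from (Sat-emb d A []) (S-sound A s)
  MainAx-valid (induct i)      = IndAx-valid i
  MainAx-valid (logical l)     = LogAx-valid l
  MainAx-valid (ax1 A B) = valid-∀* (□⌜ A ∨' B ⌝ ⇔' (□⌜ A ⌝ ∨' □⌜ B ⌝)) λ d ρ →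
    ⇒-intro d (λ
      { zero    _ _ k → k (inj₁ (Sat-□-zero A ρ))
      ; (suc e) _ x   → ¬¬-map (Sum.map (from (Sat-□-suc e A ρ)) (from (Sat-□-suc e B ρ)))
                                (to (Sat-□-suc e (A ∨' B) ρ) x) })
    , ⇒□-intro d _ (A ∨' B) ρ λ e _ →
        ¬¬-map (Sum.map (to (Sat-□-suc e A ρ)) (to (Sat-□-suc e B ρ)))
  MainAx-valid (ax2 A B) = valid-∀* (□⌜ A ∧' B ⌝ ⇔' (□⌜ A ⌝ ∧' □⌜ B ⌝)) λ d ρ →
    ⇒-intro d (λ
      { zero    _ _ → Sat-□-zero A ρ , Sat-□-zero B ρ
      ; (suc e) _ x → let a , b = to (Sat-□-suc e (A ∧' B) ρ) x
                      in from (Sat-□-suc e A ρ) a , from (Sat-□-suc e B ρ) b })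
    , ⇒□-intro d _ (A ∧' B) ρ λ
        { e _ (a , b) → to (Sat-□-suc e A ρ) a , to (Sat-□-suc e B ρ) b }
  MainAx-valid (ax3 A) = valid-∀* (∃' □⌜ A ⌝ ⇒' □⌜ ∃' A ⌝) λ d ρ →
    ⇒□-intro d _ (∃' A) ρ λ e _ → ¬¬-map λ (v , a) → v , to (Sat-□-suc e A (v ∷ ρ)) a
  MainAx-valid (ax4 A) = valid-∀* (□⌜ ∀' A ⌝ ⇔' ∀' □⌜ A ⌝) λ d ρ →
    ⇒-intro d (λ
      { zero    _ _ v → Sat-□-zero A (v ∷ ρ)
      ; (suc e) _ x v → from (Sat-□-suc e A (v ∷ ρ)) (to (Sat-□-suc e (∀' A) ρ) x v) })
    , ⇒□-intro d _ (∀' A) ρ λ e _ x v → to (Sat-□-suc e A (v ∷ ρ)) (x v)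
  MainAx-valid (ax5 A B) = valid-∀* (□⌜ A ⇒' B ⌝ ⇒' (□⌜ A ⌝ ⇒' □⌜ B ⌝)) λ d ρ →
    ⇒-intro d λ e _ □A⇒B → ⇒□-intro e _ B ρ λ e' e'<e □A →
      ⇒-elim e' {A} {B} (to (Sat-□-suc e' (A ⇒' B) ρ) (Sat-antitone □⌜ A ⇒' B ⌝ e'<e □A⇒B))
                        (to (Sat-□-suc e' A ρ) □A)
  MainAx-valid (ax6 A) = valid-∀* (A ⇒' □⌜ A ⌝) λ d ρ →
    ⇒□-intro d A A ρ λ e _ → Sat-pred e A ρ

  jump-valid : Valid jump
  jump-valid d g = ⇒-intro d λ
    { zero    _ _  → tt
    ; (suc e) _ ax → let B , main-B , code≡g = to (Ax-correct g) (to (Sat-emb (suc e) AxF (g ∷ [])) ax)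
                     in λ k → k (B , code≡g , MainAx-valid main-B e) }

  sound : ∀ {B} → ThmSBox B → Valid B
  sound (nonlog (main m))  = MainAx-valid m
  sound (nonlog jumpAx)    = jump-valid
  sound (logic l)          = LogAx-valid l
  sound (mp A B ⊢A ⊢A⇒B) d = from (Sat-∀* d B) λ ρ →
    ⇒-elim d (to (Sat-∀* d (A ⇒' B)) (sound ⊢A⇒B d) ρ) (to (Sat-∀* d A) (sound ⊢A d) ρ)

  Sat-□^-elim : ∀ k X → Sat k (□^ k X) [] → Sat zero X []
  Sat-□^-elim zero    X = id
  Sat-□^-elim (suc k) X = Sat-□^-elim k X ∘ to (Sat-□-suc k (□^ k X) [])

  false-□^-unprovable : ∀ {A} → ¬ True A → ∀ k → ¬ ThmSBox (□^ k (emb A))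
  false-□^-unprovable {A} ¬A k ⊢□^A =
    ¬A (to (Sat-emb zero A []) (Sat-□^-elim k (emb A) (sound ⊢□^A k)))

theorem3p2 : (SAx : Fm false 0 → Set)
    → ((A : Fm false 0) → Dec (SAx A))
    → (∀ {n} (A : Fm false n) → SAx (∀* (A ∨' ¬' A)))
    → ((A : Fm false 0) → Deriv PAAx A → Deriv SAx A)
    → (Sb : Fm false 3) → (AxF : Fm false 1)
    → SBox.SbCorrect SAx Sb AxF
    → SBox.AxCorrect SAx Sb AxF
    → SBox.AxPAProvable SAx Sb AxF
    → ((A : Fm false 0) → SAx A → True A)
    → (A : Fm false 0) → ¬ True A
    → ¬ SBox.ThmSBox SAx Sb AxF (emb A)
      × ((k : ℕ) → 1 ≤ k → ¬ SBox.ThmSBox SAx Sb AxF (SBox.□^ SAx Sb AxF k (emb A)))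
theorem3p2 SAx _ _ _ Sb AxF Sb-correct Ax-correct _ S-sound A ¬A =
  false-□^-unprovable ¬A 0 , λ k _ → false-□^-unprovable ¬A k
  where open Soundness SAx Sb AxF Sb-correct Ax-correct S-sound
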